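{- If $b>1$ is an odd integer, there exists a subgroup $G\le\mathfrak{S}_{2b}$ such that the homology of $(\mathcal{C}(\mathbb{F}_2)^G,D)$ is not concentrated in even dimensions.
   Context: For $G\le\mathfrak{S}_n$ acting on $[n]$: let $V$ be the $\mathbb{F}_2$-space with basis $\{e_0,e_1\}$, $\mathcal{C}(\mathbb{F}_2)=V^{\otimes n}$ with basis $e_S$ ($S\subseteq[n]$; $e_S=e_{i_1}\otimes\cdots\otimes e_{i_n}$ with $i_j=1$ iff $j\in S$), graded by $|S|$, with $G$ permuting the $e_S$ via its action on subsets. $\mathcal{C}(\mathbb{F}_2)^G$ is the graded subspace of $G$-invariants, with boundary map induced by $D(e_S)=\sum_{j\in S}e_{S\setminus\{j\}}$. Homology concentrated in even dimensions means $H_i=0$ for all odd $i$. -}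

module Defs where

open import Data.Nat using (ℕ; suc; _*_)
open import Data.Bool using (Bool; true; false; _xor_; if_then_else_)
open import Data.Fin using (Fin)
open import Data.Fin.Subset using (Subset; ∣_∣)
open import Data.Fin.Permutation using (Permutation; _⟨$⟩ˡ_; id; flip; _∘ₚ_)
open import Data.Vec using (lookup; tabulate; _[_]≔_)
open import Data.List using (foldr)
import Data.List as List
open import Data.Product using (Σ; _×_; ∃)
open import Relation.Nullary using (¬_)
open import Relation.Binary.PropositionalEquality using (_≡_)
open import Level using (Level; _⊔_) renaming (suc to lsuc; zero to lzero)

-- The field F₂ is Bool, with addition _xor_.
F₂ : Set
F₂ = Bool

Σ₂ : ∀ {n} → (Fin n → F₂) → F₂
Σ₂ {n} f = foldr _xor_ false (List.tabulate f)

record Subgroup (n : ℕ) : Set₁ where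
  field
    _∈G : Permutation n n → Set
    id∈ : id ∈G
    ∘∈ : ∀ {g h} → g ∈G → h ∈G → (g ∘ₚ h) ∈G
    inv∈ : ∀ {g} → g ∈G → flip g ∈G
open Subgroup public

-- Chains: elements of C(F₂) = V^{⊗n}, written as coefficient functions
-- x with x = Σ_S x(S) e_S, S ranging over subsets of [n].
Chain : ℕ → Set
Chain n = Subset n → F₂

act : ∀ {n} → Permutation n n → Subset n → Subset n
act g S = tabulate (λ j → lookup S (g ⟨$⟩ˡ j))

Homogeneous : ∀ {n} → ℕ → Chain n → Set
Homogeneous i x = ∀ S → x S ≡ true → ∣ S ∣ ≡ i

Invariant : ∀ {n} → Subgroup n → Chain n → Set
Invariant G x = ∀ g → _∈G G g → ∀ S → x (act g S) ≡ x S

-- Boundary D(e_S) = Σ_{j∈S} e_{S∖{j}}; on coefficients,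
-- (D x)(T) = Σ_{j ∉ T} x(T ∪ {j}).
D : ∀ {n} → Chain n → Chain n
D x T = Σ₂ (λ j → if lookup T j then false else x (T [ j ]≔ true))

InvChain : ∀ {n} → Subgroup n → ℕ → Chain n → Set
InvChain G i x = Homogeneous i x × Invariant G x

HomologyNonzero : ∀ {n} → Subgroup n → ℕ → Set
HomologyNonzero G i =
  Σ (Chain _) λ x → InvChain G i x × (∀ T → D x T ≡ false)
    × ¬ (Σ (Chain _) λ y → InvChain G (suc i) y × (∀ T → D y T ≡ x T))

NotEvenConcentrated : ∀ {n} → Subgroup n → Set
NotEvenConcentrated G = ∃ λ k → HomologyNonzero G (suc (2 * k))

-- Split [2b] into b pairs {2i, 2i+1}. A subset meeting every pair exactly once is a
-- transversal; let E be the sum of the transversals taking the second point of an even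
-- number of pairs. D E is the sum of the subsets missing exactly one pair and meeting the
-- others once, and so is D Y, where Y is the sum of the b-subsets that are either full on
-- pair 0 and empty on one other pair, or empty on pair 0 and full on pair 1. Hence
-- z = E + Y is a b-cycle. Let G be its stabiliser; it contains every product of the swap
-- of pair 0 with the swap of another pair. For a G-invariant y, the terms of D y at
-- S₀ = {0, 2, 4, …} and at S₁ = {1, 2, 4, …} are matched by such products, so
-- D y (S₀) = D y (S₁); but z (S₀) = 1 and z (S₁) = 0. Thus z is not an invariant boundary
-- and H_b ≠ 0 with b odd.
module Submission where

open import Defs
open import Data.Bool using (Bool; true; false; not; _xor_; if_then_else_)
open import Data.Bool.Properties using (not-involutive; xor-same; xor-identityʳ)
open import Data.Fin using (Fin; zero; suc)
open import Data.Fin.Subset using (Subset; ∣_∣)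
open import Data.Fin.Permutation using (Permutation; _⟨$⟩ˡ_; id; flip; _∘ₚ_; permutation; inverseʳ)
open import Data.List using (foldr)
import Data.List.Properties as List
open import Data.Nat using (ℕ; zero; suc; _+_; _*_; _<_; _/_; _%_; s≤s)
open import Data.Nat.DivMod using (m≡m%n+[m/n]*n)
open import Data.Nat.Properties using (+-suc; *-comm)
open import Data.Product using (Σ; _,_)
open import Data.Vec using (_∷_; []; lookup; tabulate; _[_]≔_)
open import Data.Vec.Properties using (tabulate∘lookup; tabulate-cong; lookup∘tabulate)
open import Relation.Nullary using (¬_)
open import Relation.Binary.PropositionalEquality
  using (_≡_; refl; sym; trans; cong; subst; module ≡-Reasoning)

act-id : ∀ {n} (S : Subset n) → act id S ≡ S
act-id = tabulate∘lookup

act-∘ : ∀ {n} (g h : Permutation n n) S → act (g ∘ₚ h) S ≡ act h (act g S)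
act-∘ g h S = tabulate-cong (λ i → sym (lookup∘tabulate _ (h ⟨$⟩ˡ i)))

act-flip : ∀ {n} (g : Permutation n n) S → act g (act (flip g) S) ≡ S
act-flip g S = trans
  (tabulate-cong (λ i → trans (lookup∘tabulate _ (g ⟨$⟩ˡ i)) (cong (lookup S) (inverseʳ g))))
  (tabulate∘lookup S)

act-pointwise : ∀ {n} (g : Permutation n n) S V →
  (∀ i → lookup S (g ⟨$⟩ˡ i) ≡ lookup V i) → act g S ≡ V
act-pointwise g S V eq = trans (tabulate-cong eq) (tabulate∘lookup V)

Stabilizer : ∀ {n} → Chain n → Subgroup n
Stabilizer x = record
  { _∈G = λ g → ∀ S → x (act g S) ≡ x S
  ; id∈ = λ S → cong x (act-id S)
  ; ∘∈ = λ {g} {h} g∈ h∈ S → trans (cong x (act-∘ g h S)) (trans (h∈ (act g S)) (g∈ S))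
  ; inv∈ = λ {g} g∈ S → trans (sym (g∈ (act (flip g) S))) (cong x (act-flip g S))
  }

Σ₂-cong : ∀ {n} {f g : Fin n → F₂} → (∀ j → f j ≡ g j) → Σ₂ f ≡ Σ₂ g
Σ₂-cong eq = cong (foldr _xor_ false) (List.tabulate-cong eq)

-- D x (a ∷ T) unfolds definitionally to
-- (if a then false else x (true ∷ T)) xor D (λ R → x (a ∷ R)) T;
-- every boundary computation below is an induction along this equation.

D-zero : ∀ {n} (T : Subset n) → D (λ _ → false) T ≡ false
D-zero [] = refl
D-zero (true ∷ T) = D-zero T
D-zero (false ∷ T) = D-zero T

D-cong-cofaces : ∀ {n} (x x′ : Chain n) T →
  (∀ j → lookup T j ≡ false → x (T [ j ]≔ true) ≡ x′ (T [ j ]≔ true)) →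
  D x T ≡ D x′ T
D-cong-cofaces x x′ T eq = Σ₂-cong term
  where
  term : ∀ j → (if lookup T j then false else x (T [ j ]≔ true))
             ≡ (if lookup T j then false else x′ (T [ j ]≔ true))
  term j with lookup T j in j∉T
  ... | true = refl
  ... | false = eq j j∉T

xor-cancelˡ : ∀ a c → a xor (a xor c) ≡ c
xor-cancelˡ true c = not-involutive c
xor-cancelˡ false c = refl

twice : ℕ → ℕ
twice zero = zero
twice (suc m) = suc (suc (twice m))

twice≡2* : ∀ n → twice n ≡ 2 * n
twice≡2* zero = refl
twice≡2* (suc n) = cong suc (trans (cong suc (twice≡2* n)) (sym (+-suc n (n + 0))))

pattern left S = true ∷ false ∷ S
pattern right S = false ∷ true ∷ S
pattern both S = true ∷ true ∷ S
pattern none S = false ∷ false ∷ S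

-- Transversals whose number of right points has parity p.
transversal : Bool → ∀ m → Subset (twice m) → F₂
transversal p zero [] = not p
transversal p (suc m) (left S) = transversal p m S
transversal p (suc m) (right S) = transversal (not p) m S
transversal p (suc m) (both S) = false
transversal p (suc m) (none S) = false

isTransversal : ∀ m → Subset (twice m) → F₂
isTransversal zero [] = true
isTransversal (suc m) (left S) = isTransversal m S
isTransversal (suc m) (right S) = isTransversal m S
isTransversal (suc m) (both S) = false
isTransversal (suc m) (none S) = false

oneGap : ∀ m → Subset (twice m) → F₂
oneGap zero [] = false
oneGap (suc m) (left S) = oneGap m S
oneGap (suc m) (right S) = oneGap m S
oneGap (suc m) (both S) = false
oneGap (suc m) (none S) = isTransversal m S

fullHead : ∀ m → Subset (twice (suc m)) → F₂
fullHead m (left S) = false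
fullHead m (right S) = false
fullHead m (both S) = isTransversal m S
fullHead m (none S) = false

cycle : ∀ m → Subset (twice (suc (suc m))) → F₂
cycle m (left S) = transversal false (suc m) S
cycle m (right S) = transversal true (suc m) S
cycle m (both S) = oneGap (suc m) S
cycle m (none S) = fullHead m S

transversal-xor-not : ∀ p m S → transversal p m S xor transversal (not p) m S ≡ isTransversal m S
transversal-xor-not true zero [] = refl
transversal-xor-not false zero [] = refl
transversal-xor-not p (suc m) (left S) = transversal-xor-not p m S
transversal-xor-not p (suc m) (right S) = transversal-xor-not (not p) m S
transversal-xor-not p (suc m) (both S) = refl
transversal-xor-not p (suc m) (none S) = refl

D-transversal : ∀ p m T → D (transversal p m) T ≡ oneGap m T
D-transversal p zero [] = refl
D-transversal p (suc m) (left T) = D-transversal p m T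
D-transversal p (suc m) (right T) = D-transversal (not p) m T
D-transversal p (suc m) (both T) = D-zero T
D-transversal p (suc m) (none T) = begin
  transversal p m T xor (transversal (not p) m T xor D (λ _ → false) T)
    ≡⟨ cong (λ c → transversal p m T xor (transversal (not p) m T xor c)) (D-zero T) ⟩
  transversal p m T xor (transversal (not p) m T xor false)
    ≡⟨ cong (transversal p m T xor_) (xor-identityʳ _) ⟩
  transversal p m T xor transversal (not p) m T
    ≡⟨ transversal-xor-not p m T ⟩
  isTransversal m T ∎
  where open ≡-Reasoning

D-isTransversal : ∀ m T → D (isTransversal m) T ≡ false
D-isTransversal zero [] = refl
D-isTransversal (suc m) (left T) = D-isTransversal m T
D-isTransversal (suc m) (right T) = D-isTransversal m T
D-isTransversal (suc m) (both T) = D-zero T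
D-isTransversal (suc m) (none T) =
  trans (xor-cancelˡ (isTransversal m T) _) (D-zero T)

D-oneGap : ∀ m T → D (oneGap m) T ≡ false
D-oneGap zero [] = refl
D-oneGap (suc m) (left T) = D-oneGap m T
D-oneGap (suc m) (right T) = D-oneGap m T
D-oneGap (suc m) (both T) = D-zero T
D-oneGap (suc m) (none T) =
  trans (xor-cancelˡ (oneGap m T) _) (D-isTransversal m T)

D-fullHead : ∀ m T → D (fullHead m) T ≡ isTransversal (suc m) T
D-fullHead m (left T) = trans (cong (isTransversal m T xor_) (D-zero T)) (xor-identityʳ _)
D-fullHead m (right T) = trans (cong (isTransversal m T xor_) (D-zero T)) (xor-identityʳ _)
D-fullHead m (both T) = D-isTransversal m T
D-fullHead m (none T) = D-zero T

D-cycle : ∀ m T → D (cycle m) T ≡ false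
D-cycle m (left T) = trans (cong (oneGap (suc m) T xor_) (D-transversal false (suc m) T)) (xor-same (oneGap (suc m) T))
D-cycle m (right T) = trans (cong (oneGap (suc m) T xor_) (D-transversal true (suc m) T)) (xor-same (oneGap (suc m) T))
D-cycle m (both T) = D-oneGap (suc m) T
D-cycle m (none T) = begin
  E xor (O xor D (fullHead m) T)  ≡⟨ cong (λ c → E xor (O xor c)) (D-fullHead m T) ⟩
  E xor (O xor isTransversal (suc m) T)  ≡⟨ cong (λ c → E xor (O xor c)) (sym (transversal-xor-not false (suc m) T)) ⟩
  E xor (O xor (E xor O))  ≡⟨ xor-cancel E O ⟩
  false ∎
  where
  open ≡-Reasoning
  E = transversal false (suc m) T
  O = transversal true (suc m) T
  xor-cancel : ∀ a b → a xor (b xor (a xor b)) ≡ false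
  xor-cancel true true = refl
  xor-cancel true false = refl
  xor-cancel false true = refl
  xor-cancel false false = refl

transversal-size : ∀ p m S → transversal p m S ≡ true → ∣ S ∣ ≡ m
transversal-size p zero [] _ = refl
transversal-size p (suc m) (left S) e = cong suc (transversal-size p m S e)
transversal-size p (suc m) (right S) e = cong suc (transversal-size (not p) m S e)

isTransversal-size : ∀ m S → isTransversal m S ≡ true → ∣ S ∣ ≡ m
isTransversal-size zero [] _ = refl
isTransversal-size (suc m) (left S) e = cong suc (isTransversal-size m S e)
isTransversal-size (suc m) (right S) e = cong suc (isTransversal-size m S e)

oneGap-size : ∀ m S → oneGap m S ≡ true → suc ∣ S ∣ ≡ m
oneGap-size zero [] ()
oneGap-size (suc m) (left S) e = cong suc (oneGap-size m S e)
oneGap-size (suc m) (right S) e = cong suc (oneGap-size m S e)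
oneGap-size (suc m) (none S) e = cong suc (isTransversal-size m S e)

cycle-homogeneous : ∀ m → Homogeneous (suc (suc m)) (cycle m)
cycle-homogeneous m (left S) e = cong suc (transversal-size false (suc m) S e)
cycle-homogeneous m (right S) e = cong suc (transversal-size true (suc m) S e)
cycle-homogeneous m (both S) e = cong suc (oneGap-size (suc m) S e)
cycle-homogeneous m (none (left S)) ()
cycle-homogeneous m (none (right S)) ()
cycle-homogeneous m (none (both S)) e = cong (λ k → suc (suc k)) (isTransversal-size m S e)
cycle-homogeneous m (none (none S)) ()

swapPair : ∀ {m} → Fin m → Fin (twice m) → Fin (twice m)
swapPair {suc m} zero zero = suc zero
swapPair {suc m} zero (suc zero) = zero
swapPair {suc m} zero (suc (suc i)) = suc (suc i)
swapPair {suc m} (suc k) zero = zero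
swapPair {suc m} (suc k) (suc zero) = suc zero
swapPair {suc m} (suc k) (suc (suc i)) = suc (suc (swapPair k i))

swapPair-involutive : ∀ {m} (k : Fin m) i → swapPair k (swapPair k i) ≡ i
swapPair-involutive {suc m} zero zero = refl
swapPair-involutive {suc m} zero (suc zero) = refl
swapPair-involutive {suc m} zero (suc (suc i)) = refl
swapPair-involutive {suc m} (suc k) zero = refl
swapPair-involutive {suc m} (suc k) (suc zero) = refl
swapPair-involutive {suc m} (suc k) (suc (suc i)) = cong (λ j → suc (suc j)) (swapPair-involutive k i)

pairSwap : ∀ {m} → Fin m → Permutation (twice m) (twice m)
pairSwap k = permutation (swapPair k) (swapPair k) (swapPair-involutive k) (swapPair-involutive k)

flipPair : ∀ {m} → Fin m → Subset (twice m) → Subset (twice m)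
flipPair {suc m} zero (a ∷ b ∷ S) = b ∷ a ∷ S
flipPair {suc m} (suc k) (a ∷ b ∷ S) = a ∷ b ∷ flipPair k S

lookup-swapPair : ∀ {m} (k : Fin m) S i → lookup S (swapPair k i) ≡ lookup (flipPair k S) i
lookup-swapPair {suc m} zero (a ∷ b ∷ S) zero = refl
lookup-swapPair {suc m} zero (a ∷ b ∷ S) (suc zero) = refl
lookup-swapPair {suc m} zero (a ∷ b ∷ S) (suc (suc i)) = refl
lookup-swapPair {suc m} (suc k) (a ∷ b ∷ S) zero = refl
lookup-swapPair {suc m} (suc k) (a ∷ b ∷ S) (suc zero) = refl
lookup-swapPair {suc m} (suc k) (a ∷ b ∷ S) (suc (suc i)) = lookup-swapPair k S i

act-pairSwap : ∀ {m} (k : Fin m) S → act (pairSwap k) S ≡ flipPair k S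
act-pairSwap k S = act-pointwise (pairSwap k) S (flipPair k S) (lookup-swapPair k S)

doubleSwap : ∀ {m} → Fin m → Permutation (twice (suc m)) (twice (suc m))
doubleSwap k = pairSwap zero ∘ₚ pairSwap (suc k)

act-doubleSwap : ∀ {m} (k : Fin m) S → act (doubleSwap k) S ≡ flipPair (suc k) (flipPair zero S)
act-doubleSwap k S = begin
  act (pairSwap zero ∘ₚ pairSwap (suc k)) S         ≡⟨ act-∘ (pairSwap zero) (pairSwap (suc k)) S ⟩
  act (pairSwap (suc k)) (act (pairSwap zero) S)    ≡⟨ cong (act (pairSwap (suc k))) (act-pairSwap zero S) ⟩
  act (pairSwap (suc k)) (flipPair zero S)          ≡⟨ act-pairSwap (suc k) (flipPair zero S) ⟩
  flipPair (suc k) (flipPair zero S) ∎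
  where open ≡-Reasoning

transversal-flipPair : ∀ p {m} (k : Fin m) S → transversal p m (flipPair k S) ≡ transversal (not p) m S
transversal-flipPair p {suc m} zero (left S) = refl
transversal-flipPair p {suc m} zero (right S) = cong (λ q → transversal q m S) (sym (not-involutive p))
transversal-flipPair p {suc m} zero (both S) = refl
transversal-flipPair p {suc m} zero (none S) = refl
transversal-flipPair p {suc m} (suc k) (left S) = transversal-flipPair p k S
transversal-flipPair p {suc m} (suc k) (right S) = transversal-flipPair (not p) k S
transversal-flipPair p {suc m} (suc k) (both S) = refl
transversal-flipPair p {suc m} (suc k) (none S) = refl

isTransversal-flipPair : ∀ {m} (k : Fin m) S → isTransversal m (flipPair k S) ≡ isTransversal m S
isTransversal-flipPair {suc m} zero (left S) = refl
isTransversal-flipPair {suc m} zero (right S) = refl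
isTransversal-flipPair {suc m} zero (both S) = refl
isTransversal-flipPair {suc m} zero (none S) = refl
isTransversal-flipPair {suc m} (suc k) (left S) = isTransversal-flipPair k S
isTransversal-flipPair {suc m} (suc k) (right S) = isTransversal-flipPair k S
isTransversal-flipPair {suc m} (suc k) (both S) = refl
isTransversal-flipPair {suc m} (suc k) (none S) = refl

oneGap-flipPair : ∀ {m} (k : Fin m) S → oneGap m (flipPair k S) ≡ oneGap m S
oneGap-flipPair {suc m} zero (left S) = refl
oneGap-flipPair {suc m} zero (right S) = refl
oneGap-flipPair {suc m} zero (both S) = refl
oneGap-flipPair {suc m} zero (none S) = refl
oneGap-flipPair {suc m} (suc k) (left S) = oneGap-flipPair k S
oneGap-flipPair {suc m} (suc k) (right S) = oneGap-flipPair k S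
oneGap-flipPair {suc m} (suc k) (both S) = refl
oneGap-flipPair {suc m} (suc k) (none S) = isTransversal-flipPair k S

fullHead-flipPair : ∀ {m} (k : Fin (suc m)) S → fullHead m (flipPair k S) ≡ fullHead m S
fullHead-flipPair zero (left S) = refl
fullHead-flipPair zero (right S) = refl
fullHead-flipPair zero (both S) = refl
fullHead-flipPair zero (none S) = refl
fullHead-flipPair (suc k) (left S) = refl
fullHead-flipPair (suc k) (right S) = refl
fullHead-flipPair (suc k) (both S) = isTransversal-flipPair k S
fullHead-flipPair (suc k) (none S) = refl

cycle-flipPair² : ∀ m (k : Fin (suc m)) S → cycle m (flipPair (suc k) (flipPair zero S)) ≡ cycle m S
cycle-flipPair² m k (left S) = transversal-flipPair true k S
cycle-flipPair² m k (right S) = transversal-flipPair false k S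
cycle-flipPair² m k (both S) = oneGap-flipPair k S
cycle-flipPair² m k (none S) = fullHead-flipPair k S

doubleSwap∈Stabilizer : ∀ m (k : Fin (suc m)) → _∈G (Stabilizer (cycle m)) (doubleSwap k)
doubleSwap∈Stabilizer m k S = trans (cong (cycle m) (act-doubleSwap k S)) (cycle-flipPair² m k S)

leftTransversal : ∀ m → Subset (twice m)
leftTransversal zero = []
leftTransversal (suc m) = left (leftTransversal m)

transversal-leftTransversal : ∀ p m → transversal p m (leftTransversal m) ≡ not p
transversal-leftTransversal p zero = refl
transversal-leftTransversal p (suc m) = transversal-leftTransversal p m

pairOf : ∀ {m} → Fin (twice m) → Fin m
pairOf {suc m} zero = zero
pairOf {suc m} (suc zero) = zero
pairOf {suc m} (suc (suc i)) = suc (pairOf i)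

flipPair-fill : ∀ m (j : Fin (twice m)) → lookup (leftTransversal m) j ≡ false →
  flipPair (pairOf j) (leftTransversal m [ j ]≔ true) ≡ leftTransversal m [ j ]≔ true
flipPair-fill (suc m) (suc zero) _ = refl
flipPair-fill (suc m) (suc (suc i)) j∉ = cong left (flipPair-fill m i j∉)

D-left≡D-right : ∀ m (y : Chain (twice (suc m))) →
  (∀ k S → y (act (doubleSwap k) S) ≡ y S) →
  D y (left (leftTransversal m)) ≡ D y (right (leftTransversal m))
D-left≡D-right m y y-inv =
  cong (y (both A) xor_) (D-cong-cofaces (λ R → y (left R)) (λ R → y (right R)) A coface)
  where
  A = leftTransversal m
  coface : ∀ j → lookup A j ≡ false → y (left (A [ j ]≔ true)) ≡ y (right (A [ j ]≔ true))
  coface j j∉A = trans (sym (y-inv (pairOf j) (left (A [ j ]≔ true))))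
    (cong y (trans (act-doubleSwap (pairOf j) (left (A [ j ]≔ true))) (cong right (flipPair-fill m j j∉A))))

cycle-not-boundary : ∀ m (y : Chain (twice (suc (suc m)))) →
  (∀ k S → y (act (doubleSwap k) S) ≡ y S) → ¬ (∀ T → D y T ≡ cycle m T)
cycle-not-boundary m y y-inv ∂y≡cycle = true≢false (begin
  true                     ≡⟨ sym (transversal-leftTransversal false (suc m)) ⟩
  cycle m (left A)         ≡⟨ sym (∂y≡cycle (left A)) ⟩
  D y (left A)             ≡⟨ D-left≡D-right (suc m) y y-inv ⟩
  D y (right A)            ≡⟨ ∂y≡cycle (right A) ⟩
  cycle m (right A)        ≡⟨ transversal-leftTransversal true (suc m) ⟩
  false ∎)
  where
  open ≡-Reasoning
  A = leftTransversal (suc m)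
  true≢false : ¬ (true ≡ false)
  true≢false ()

homology-cycle : ∀ m → HomologyNonzero (Stabilizer (cycle m)) (suc (suc m))
homology-cycle m =
  cycle m , (cycle-homogeneous m , λ g g∈G → g∈G) , D-cycle m ,
  λ { (y , (_ , y-inv) , ∂y≡cycle) →
        cycle-not-boundary m y (λ k → y-inv (doubleSwap k) (doubleSwap∈Stabilizer m k)) ∂y≡cycle }

odd≡suc2*half : ∀ b → b % 2 ≡ 1 → b ≡ suc (2 * (b / 2))
odd≡suc2*half b b-odd = trans (m≡m%n+[m/n]*n b 2)
  (trans (cong (_+ (b / 2) * 2) b-odd) (cong suc (*-comm (b / 2) 2)))

proposition6p2 : (b : ℕ) → 1 < b → b % 2 ≡ 1 →
    Σ (Subgroup (2 * b)) λ G → NotEvenConcentrated G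
proposition6p2 (suc zero) (s≤s ()) _
proposition6p2 b@(suc (suc m)) _ b-odd =
  subst (λ n → Σ (Subgroup n) NotEvenConcentrated) (twice≡2* b)
    (Stabilizer (cycle m) , b / 2 ,
      subst (HomologyNonzero (Stabilizer (cycle m))) (odd≡suc2*half b b-odd) (homology-cycle m))
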